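{- Let $q$ be a power of an odd prime, $c\in\mathbb{F}_q^*$, and $f:\mathbb{F}_{q^2}\to\mathbb{F}_{q^2}$, $f(X)=c(X^{q+1}+X^2)$. Let $\beta\in\mathbb{F}_{q^2}$ with $\beta^2=b$, $b$ a non-square in $\mathbb{F}_q$. If $\alpha\in\mathbb{F}_{q^2}\setminus\beta\mathbb{F}_q$, then the number of $\gamma\in\mathbb{F}_{q^2}$ with $f(\gamma)=\alpha$ is either $0$ or $2$.
   Context: $\beta\mathbb{F}_q=\{\beta t: t\in\mathbb{F}_q\}$. -}

module Defs where

open import Level using (Level; _⊔_) renaming (suc to lsuc)
open import Data.Nat using (ℕ; zero; suc)
open import Data.Fin using (Fin)
open import Data.Product using (Σ; ∃; _×_; _,_)
open import Data.List using (List; length; filter)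
open import Data.List using () renaming (allFin to allFinL)
open import Data.Bool using (Bool; true; false)
open import Relation.Nullary using (¬_; Dec; yes; no)
open import Relation.Nullary.Decidable using (⌊_⌋)
open import Relation.Unary using (Pred; Decidable)
open import Algebra.Bundles using (CommutativeRing)
open import Relation.Binary.PropositionalEquality using (_≡_)

record FiniteField (c ℓ : Level) : Set (lsuc (c ⊔ ℓ)) where
  field
    commRing : CommutativeRing c ℓ
  open CommutativeRing commRing public
  field
    1≉0     : ¬ (1# ≈ 0#)
    inverse : ∀ x → ¬ (x ≈ 0#) → ∃ λ y → x * y ≈ 1#
    _≟_     : ∀ x y → Dec (x ≈ y)
    size    : ℕ
    enum    : Fin size → Carrier
    enum-injective  : ∀ i j → enum i ≈ enum j → i ≡ j
    enum-surjective : ∀ x → ∃ λ i → enum i ≈ x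

  infixr 8 _^_
  _^_ : Carrier → ℕ → Carrier
  x ^ zero  = 1#
  x ^ suc n = x * (x ^ n)

  count : {P : Pred Carrier ℓ} → Decidable P → ℕ
  count P? = length (filter (λ i → P? (enum i)) (allFinL size))

-- Write f(X) = c X T(X) with T(X) = X^q + X, which lies in F_q because the q-power map is
-- an additive involution of F_{q^2}. If f(γ) = f(δ) = α then γ T(γ) = δ T(δ); raising to the
-- q-th power gives γ^q T(γ) = δ^q T(δ), and adding the two equations gives T(γ)² = T(δ)². Hence
-- T(δ) = ±T(γ) and then δ = ±γ. Conversely f(-γ) = f(γ), and γ ≠ -γ because α ≠ 0 forces γ ≠ 0
-- and the characteristic is odd. The hypothesis α ∉ βF_q is only used through α ≠ 0.
-- The field facts behind this (characteristic p, Frobenius, x^{q²} = x) are derived from |F| = q²: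
-- the characteristic from the sum of all elements, Fermat from the product of all units.
module Submission where

open import Defs
open import Level using (Level)
open import Data.Nat using (ℕ; suc) renaming (_*_ to _*ℕ_; _+_ to _+ℕ_; _^_ to _^ℕ_)
open import Data.Nat.Primality using (Prime)
open import Data.Product using (∃; _×_; _,_)
open import Data.Sum using (_⊎_)
open import Relation.Nullary using (¬_)
open import Relation.Binary.PropositionalEquality using (_≡_; _≢_)

open import Algebra.Bundles using (Monoid; CommutativeMonoid)
import Algebra.Properties.Monoid.Sum as MonoidSum
import Algebra.Properties.CommutativeMonoid.Sum as CommutativeMonoidSum
import Algebra.Properties.CommutativeSemiring.Binomial as Binomial
import Algebra.Properties.CommutativeSemiring.Exp as Exp
import Algebra.Properties.Ring as RingProperties
import Algebra.Properties.Semiring.Mult as Mult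
open import Data.Empty using (⊥-elim)
open import Data.Fin as Fin using (Fin; zero; suc)
import Data.Fin.Properties as Finₚ
open import Data.Fin.Permutation using (Permutation; permutation)
open import Data.List using (length; filter; tabulate)
open import Data.List.Properties using (filter-none)
open import Data.List.Relation.Unary.All.Properties using (tabulate⁺)
import Data.Nat as ℕ
open import Data.Nat using (_!)
open import Data.Nat.Combinatorics using (_C_; nCn≡1; nCk≡n!/k![n-k]!; k![n∸k]!∣n!)
open import Data.Nat.Divisibility using (_∣_; _∤_; divides; ∣1⇒≡1; ∣⇒≤; m∣m*n; m%n≡0⇒n∣m)
open import Data.Nat.DivMod using (_/_; _%_; m≡m%n+[m/n]*n; m%n<n; m/n*n≡m)
open import Data.Nat.Primality using (prime; euclidsLemma; prime⇒nonTrivial; prime⇒nonZero; prime⇒irreducible)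
import Data.Nat.Properties as ℕₚ
open import Data.Product using (proj₁; proj₂)
open import Data.Sum using (inj₁; inj₂; reduce)
open import Function using (_∘_)
open import Relation.Nullary using (yes; no)
open import Relation.Unary using (Pred; Decidable)
open import Relation.Binary.PropositionalEquality as ≡ using (cong; subst)

module _ {a q} {A : Set a} {Q : Pred A q} (Q? : Decidable Q) where

  length-filter-tabulate-none : ∀ {n} (t : Fin n → A) → (∀ i → ¬ Q (t i)) →
                                length (filter Q? (tabulate t)) ≡ 0
  length-filter-tabulate-none t ¬Q = cong length (filter-none Q? (tabulate⁺ ¬Q))

  length-filter-tabulate-one : ∀ {n} (t : Fin n → A) i → Q (t i) → (∀ j → Q (t j) → j ≡ i) →
                               length (filter Q? (tabulate t)) ≡ 1
  length-filter-tabulate-one t zero Qi only with Q? (t zero)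
  ... | yes _ = cong suc (length-filter-tabulate-none (t ∘ suc) λ j Qj → Finₚ.0≢1+n (≡.sym (only (suc j) Qj)))
  ... | no ¬Q0 = ⊥-elim (¬Q0 Qi)
  length-filter-tabulate-one t (suc i) Qi only with Q? (t zero)
  ... | yes Q0 = ⊥-elim (Finₚ.0≢1+n (only zero Q0))
  ... | no _ = length-filter-tabulate-one (t ∘ suc) i Qi λ j Qj → Finₚ.suc-injective (only (suc j) Qj)

  length-filter-tabulate-two : ∀ {n} (t : Fin n → A) i j → i ≢ j → Q (t i) → Q (t j) →
                               (∀ m → Q (t m) → m ≡ i ⊎ m ≡ j) → length (filter Q? (tabulate t)) ≡ 2
  length-filter-tabulate-two t zero zero i≢j _ _ _ = ⊥-elim (i≢j ≡.refl)
  length-filter-tabulate-two t zero (suc j) _ Qi Qj only with Q? (t zero)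
  ... | yes _ = cong suc (length-filter-tabulate-one (t ∘ suc) j Qj λ m Qm → tail (only (suc m) Qm))
    where tail : ∀ {m} → suc m ≡ zero ⊎ suc m ≡ suc j → m ≡ j
          tail (inj₂ ≡.refl) = ≡.refl
  ... | no ¬Q0 = ⊥-elim (¬Q0 Qi)
  length-filter-tabulate-two t (suc i) zero _ Qi Qj only with Q? (t zero)
  ... | yes _ = cong suc (length-filter-tabulate-one (t ∘ suc) i Qi λ m Qm → tail (only (suc m) Qm))
    where tail : ∀ {m} → suc m ≡ suc i ⊎ suc m ≡ zero → m ≡ i
          tail (inj₁ ≡.refl) = ≡.refl
  ... | no ¬Q0 = ⊥-elim (¬Q0 Qj)
  length-filter-tabulate-two t (suc i) (suc j) i≢j Qi Qj only with Q? (t zero)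
  ... | yes Q0 = ⊥-elim (head (only zero Q0))
    where head : ¬ (zero ≡ suc i ⊎ zero ≡ suc j)
          head (inj₁ ())
          head (inj₂ ())
  ... | no _ = length-filter-tabulate-two (t ∘ suc) i j (i≢j ∘ cong suc) Qi Qj λ m Qm → tail (only (suc m) Qm)
    where tail : ∀ {m} → suc m ≡ suc i ⊎ suc m ≡ suc j → m ≡ i ⊎ m ≡ j
          tail (inj₁ ≡.refl) = inj₁ ≡.refl
          tail (inj₂ ≡.refl) = inj₂ ≡.refl

prime∤! : ∀ {p} → Prime p → ∀ {m} → m ℕ.< p → p ∤ m !
prime∤! pp {ℕ.zero} _ p∣1 = ℕ.nonTrivial⇒≢1 {{prime⇒nonTrivial pp}} (∣1⇒≡1 p∣1)
prime∤! pp {suc m} m<p p∣m! with euclidsLemma (suc m) (m !) pp p∣m!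
... | inj₁ p∣1+m = ℕₚ.<⇒≱ m<p (∣⇒≤ p∣1+m)
... | inj₂ p∣m! = prime∤! pp (ℕₚ.<-trans (ℕₚ.n<1+n m) m<p) p∣m!

prime∣C : ∀ {p k} → Prime p → 0 ℕ.< k → k ℕ.< p → p ∣ p C k
prime∣C {p} {k} pp 0<k k<p with euclidsLemma (p C k) (k ! *ℕ (p ℕ.∸ k) !) pp p∣C*k!*[p∸k]!
  where
  instance _ = k ℕₚ.!* (p ℕ.∸ k) !≢0
  p! : (p C k) *ℕ (k ! *ℕ (p ℕ.∸ k) !) ≡ p !
  p! = ≡.trans (cong (_*ℕ (k ! *ℕ (p ℕ.∸ k) !)) (nCk≡n!/k![n-k]! (ℕₚ.<⇒≤ k<p)))
               (m/n*n≡m (k![n∸k]!∣n! (ℕₚ.<⇒≤ k<p)))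
  n∣n! : ∀ {n} → .{{ℕ.NonZero n}} → n ∣ n !
  n∣n! {suc n} = m∣m*n (n !)
  p∣C*k!*[p∸k]! : p ∣ (p C k) *ℕ (k ! *ℕ (p ℕ.∸ k) !)
  p∣C*k!*[p∸k]! = subst (p ∣_) (≡.sym p!) (n∣n! {{prime⇒nonZero pp}})
... | inj₁ p∣C = p∣C
... | inj₂ p∣k!*[p∸k]! with euclidsLemma (k !) ((p ℕ.∸ k) !) pp p∣k!*[p∸k]!
...   | inj₁ p∣k! = ⊥-elim (prime∤! pp k<p p∣k!)
...   | inj₂ p∣[p∸k]! = ⊥-elim (prime∤! pp (ℕₚ.∸-monoʳ-< 0<k (ℕₚ.<⇒≤ k<p)) p∣[p∸k]!)

prime≢2⇒odd : ∀ {p} → Prime p → p ≢ 2 → p ≡ 1 +ℕ p / 2 *ℕ 2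
prime≢2⇒odd {p} pp p≢2 with p % 2 in p%2≡r | m%n<n p 2 | m≡m%n+[m/n]*n p 2
... | 0 | _ | _ with prime⇒irreducible pp (m%n≡0⇒n∣m p 2 p%2≡r)
...   | inj₁ ()
...   | inj₂ 2≡p = ⊥-elim (p≢2 (≡.sym 2≡p))
prime≢2⇒odd pp p≢2 | 1 | _ | p≡1+p/2*2 = p≡1+p/2*2
prime≢2⇒odd pp p≢2 | suc (suc _) | ℕ.s≤s (ℕ.s≤s ()) | _

module _ {a ℓ} (M : Monoid a ℓ) where

  open Monoid M
  open MonoidSum M using (sum; sum-cong-≋; sum-replicate-zero)

  sum-single : ∀ {n} (t : Fin n → Carrier) i → (∀ j → j ≢ i → t j ≈ ε) → sum t ≈ t i
  sum-single {suc n} t zero others = trans (∙-congˡ sum-others≈ε) (identityʳ (t zero))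
    where
    sum-others≈ε : sum (t ∘ suc) ≈ ε
    sum-others≈ε = trans (sum-cong-≋ {n} λ j → others (suc j) (λ ())) (sum-replicate-zero n)
  sum-single t (suc i) others = trans (∙-cong (others zero (λ ())) (sum-single (t ∘ suc) i others′)) (identityˡ _)
    where
    others′ : ∀ j → j ≢ i → t (suc j) ≈ ε
    others′ j j≢i = others (suc j) (j≢i ∘ Finₚ.suc-injective)

module FiniteFieldProperties {c ℓ : Level} (F : FiniteField c ℓ) where

  open FiniteField F hiding (zero)
  open RingProperties ring using (-‿distribˡ-*; -‿distribʳ-*; -‿involutive; -‿+-comm;
    +-identityʳ-unique; +-inverseˡ-unique; x∙y⁻¹≈ε⇒x≈y; x≈y⇒x∙y⁻¹≈ε)
  open Mult semiring public using () renaming (_×_ to _·_)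
  open Mult semiring using (×-assoc-*; ×1-homo-*) renaming (×-congʳ to ·-congʳ; ×-congˡ to ·-congˡ)
  module E = Exp commutativeSemiring
  open import Relation.Binary.Reasoning.Setoid setoid

  ^≈E^ : ∀ x n → x ^ n ≈ x E.^ n
  ^≈E^ x ℕ.zero = refl
  ^≈E^ x (suc n) = *-congˡ (^≈E^ x n)

  ^-congˡ : ∀ n {x y} → x ≈ y → x ^ n ≈ y ^ n
  ^-congˡ n {x} {y} x≈y = trans (^≈E^ x n) (trans (E.^-congˡ n x≈y) (sym (^≈E^ y n)))

  ^-homo-* : ∀ x m n → x ^ (m +ℕ n) ≈ x ^ m * x ^ n
  ^-homo-* x m n = trans (^≈E^ x (m +ℕ n)) (trans (E.^-homo-* x m n) (sym (*-cong (^≈E^ x m) (^≈E^ x n))))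

  ^-assocʳ : ∀ x m n → (x ^ m) ^ n ≈ x ^ (m *ℕ n)
  ^-assocʳ x m n = begin
    (x ^ m) ^ n     ≈⟨ ^≈E^ (x ^ m) n ⟩
    (x ^ m) E.^ n   ≈⟨ E.^-congˡ n (^≈E^ x m) ⟩
    (x E.^ m) E.^ n ≈⟨ E.^-assocʳ x m n ⟩
    x E.^ (m *ℕ n)  ≈⟨ ^≈E^ x (m *ℕ n) ⟨
    x ^ (m *ℕ n)    ∎

  ^-distrib-* : ∀ x y n → (x * y) ^ n ≈ x ^ n * y ^ n
  ^-distrib-* x y n = trans (^≈E^ (x * y) n) (trans (E.^-distrib-* x y n) (sym (*-cong (^≈E^ x n) (^≈E^ y n))))

  ·≈·1#* : ∀ n x → n · x ≈ (n · 1#) * x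
  ·≈·1#* n x = sym (trans (×-assoc-* n 1# x) (·-congʳ n (*-identityˡ x)))

  *-cancelˡ : ∀ {a x y} → ¬ (a ≈ 0#) → a * x ≈ a * y → x ≈ y
  *-cancelˡ {a} {x} {y} a≉0 ax≈ay with inverse a a≉0
  ... | a⁻¹ , aa⁻¹≈1 = begin
    x              ≈⟨ *-identityˡ x ⟨
    1# * x         ≈⟨ *-congʳ (trans (sym aa⁻¹≈1) (*-comm a a⁻¹)) ⟩
    (a⁻¹ * a) * x  ≈⟨ *-assoc a⁻¹ a x ⟩
    a⁻¹ * (a * x)  ≈⟨ *-congˡ ax≈ay ⟩
    a⁻¹ * (a * y)  ≈⟨ *-assoc a⁻¹ a y ⟨
    (a⁻¹ * a) * y  ≈⟨ *-congʳ (trans (*-comm a⁻¹ a) aa⁻¹≈1) ⟩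
    1# * y         ≈⟨ *-identityˡ y ⟩
    y              ∎

  x*y≈0⇒x≈0⊎y≈0 : ∀ {x y} → x * y ≈ 0# → x ≈ 0# ⊎ y ≈ 0#
  x*y≈0⇒x≈0⊎y≈0 {x} {y} xy≈0 with x ≟ 0#
  ... | yes x≈0 = inj₁ x≈0
  ... | no x≉0 = inj₂ (*-cancelˡ x≉0 (trans xy≈0 (sym (zeroʳ x))))

  *-≉0 : ∀ {x y} → ¬ (x ≈ 0#) → ¬ (y ≈ 0#) → ¬ (x * y ≈ 0#)
  *-≉0 x≉0 y≉0 xy≈0 with x*y≈0⇒x≈0⊎y≈0 xy≈0
  ... | inj₁ x≈0 = x≉0 x≈0
  ... | inj₂ y≈0 = y≉0 y≈0

  x*x≈y*y⇒x≈y⊎x≈-y : ∀ {x y} → x * x ≈ y * y → x ≈ y ⊎ x ≈ - y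
  x*x≈y*y⇒x≈y⊎x≈-y {x} {y} xx≈yy with x*y≈0⇒x≈0⊎y≈0 [x-y][x+y]≈0
    where
    [x-y][x+y]≈0 : (x - y) * (x + y) ≈ 0#
    [x-y][x+y]≈0 = begin
      (x - y) * (x + y)                  ≈⟨ distribʳ (x + y) x (- y) ⟩
      x * (x + y) + - y * (x + y)        ≈⟨ +-cong (distribˡ x x y) (distribˡ (- y) x y) ⟩
      (x * x + x * y) + (- y * x + - y * y)
        ≈⟨ +-congˡ (+-cong (sym (-‿distribˡ-* y x)) (sym (-‿distribˡ-* y y))) ⟩
      (x * x + x * y) + (- (y * x) + - (y * y))
        ≈⟨ +-cong (+-comm (x * x) (x * y)) (+-congʳ (-‿cong (*-comm y x))) ⟩
      (x * y + x * x) + (- (x * y) + - (y * y))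
        ≈⟨ +-assoc (x * y) (x * x) _ ⟩
      x * y + (x * x + (- (x * y) + - (y * y)))
        ≈⟨ +-congˡ (trans (sym (+-assoc (x * x) _ _)) (trans (+-congʳ (+-comm (x * x) _)) (+-assoc _ (x * x) _))) ⟩
      x * y + (- (x * y) + (x * x - y * y))
        ≈⟨ sym (+-assoc (x * y) _ _) ⟩
      (x * y - x * y) + (x * x - y * y)  ≈⟨ +-cong (-‿inverseʳ (x * y)) (x≈y⇒x∙y⁻¹≈ε xx≈yy) ⟩
      0# + 0#                            ≈⟨ +-identityˡ 0# ⟩
      0#                                 ∎
  ... | inj₁ x-y≈0 = inj₁ (x∙y⁻¹≈ε⇒x≈y x y x-y≈0)
  ... | inj₂ x+y≈0 = inj₂ (+-inverseˡ-unique x y x+y≈0)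

  index : Carrier → Fin size
  index x = proj₁ (enum-surjective x)

  enum-index : ∀ x → enum (index x) ≈ x
  enum-index x = proj₂ (enum-surjective x)

  module _ {m n} (M : CommutativeMonoid m n) (g g⁻¹ : Carrier → Carrier)
           (g-cong : ∀ {x y} → x ≈ y → g x ≈ g y) (g⁻¹-cong : ∀ {x y} → x ≈ y → g⁻¹ x ≈ g⁻¹ y)
           (g∘g⁻¹ : ∀ x → g (g⁻¹ x) ≈ x) (g⁻¹∘g : ∀ x → g⁻¹ (g x) ≈ x) where

    private
      module M = CommutativeMonoid M
      open CommutativeMonoidSum M using (sum; ∑-permute; sum-cong-≋)

    ∑-reindex : (t : Carrier → M.Carrier) → (∀ {x y} → x ≈ y → t x M.≈ t y) →
                sum (t ∘ enum) M.≈ sum (t ∘ g ∘ enum)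
    ∑-reindex t t-cong = M.trans (∑-permute (t ∘ enum) π) (sum-cong-≋ {size} λ i → t-cong (enum-index (g (enum i))))
      where
      π : Permutation size size
      π = permutation (λ i → index (g (enum i))) (λ i → index (g⁻¹ (enum i)))
        (λ i → enum-injective _ _ (trans (enum-index _) (trans (g-cong (enum-index _)) (g∘g⁻¹ _))))
        (λ i → enum-injective _ _ (trans (enum-index _) (trans (g⁻¹-cong (enum-index _)) (g⁻¹∘g _))))

  private
    module + = CommutativeMonoidSum +-commutativeMonoid
    module * = CommutativeMonoidSum *-commutativeMonoid

  -- Translation by 1 permutes the field, so it does not change the sum of all elements.
  size·1≈0 : size · 1# ≈ 0#
  size·1≈0 = +-identityʳ-unique S (size · 1#) (begin
    S + size · 1#                    ≈⟨ +-congˡ (+.sum-replicate size) ⟨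
    S + +.sum {size} (λ _ → 1#)      ≈⟨ +.∑-distrib-+ enum (λ _ → 1#) ⟨
    +.sum (λ i → enum i + 1#)        ≈⟨ ∑-reindex +-commutativeMonoid (_+ 1#) (_- 1#) +-congʳ +-congʳ
                                          x-1+1≈x x+1-1≈x (λ x → x) (λ x≈y → x≈y) ⟨
    S                                ∎)
    where
    S = +.sum enum
    x-1+1≈x : ∀ x → x - 1# + 1# ≈ x
    x-1+1≈x x = trans (+-assoc x (- 1#) 1#) (trans (+-congˡ (-‿inverseˡ 1#)) (+-identityʳ x))
    x+1-1≈x : ∀ x → x + 1# - 1# ≈ x
    x+1-1≈x x = trans (+-assoc x 1# (- 1#)) (trans (+-congˡ (-‿inverseʳ 1#)) (+-identityʳ x))

  -- Fermat's little theorem compares ∏ orOne (a x) with ∏ orOne x over all x: orOne makes every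
  -- factor invertible, and atZero corrects the one factor (x = 0) that x ↦ a x does not scale by a.
  orOne : Carrier → Carrier
  orOne x with x ≟ 0#
  ... | yes _ = 1#
  ... | no _ = x

  atZero : Carrier → Carrier → Carrier
  atZero a x with x ≟ 0#
  ... | yes _ = a
  ... | no _ = 1#

  orOne-≉0 : ∀ x → ¬ (orOne x ≈ 0#)
  orOne-≉0 x with x ≟ 0#
  ... | yes _ = 1≉0
  ... | no x≉0 = x≉0

  orOne-cong : ∀ {x y} → x ≈ y → orOne x ≈ orOne y
  orOne-cong {x} {y} x≈y with x ≟ 0# | y ≟ 0#
  ... | yes _ | yes _ = refl
  ... | no _ | no _ = x≈y
  ... | yes x≈0 | no y≉0 = ⊥-elim (y≉0 (trans (sym x≈y) x≈0))
  ... | no x≉0 | yes y≈0 = ⊥-elim (x≉0 (trans x≈y y≈0))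

  orOne-* : ∀ {a} → ¬ (a ≈ 0#) → ∀ x → orOne (a * x) * atZero a x ≈ a * orOne x
  orOne-* {a} a≉0 x with x ≟ 0# | (a * x) ≟ 0#
  ... | yes _ | yes _ = trans (*-identityˡ a) (sym (*-identityʳ a))
  ... | no _ | no _ = *-identityʳ (a * x)
  ... | yes x≈0 | no ax≉0 = ⊥-elim (ax≉0 (trans (*-congˡ x≈0) (zeroʳ a)))
  ... | no x≉0 | yes ax≈0 = ⊥-elim (*-≉0 a≉0 x≉0 ax≈0)

  ∏-≉0 : ∀ {n} (t : Fin n → Carrier) → (∀ i → ¬ (t i ≈ 0#)) → ¬ (*.sum t ≈ 0#)
  ∏-≉0 {ℕ.zero} t _ = 1≉0
  ∏-≉0 {suc n} t t≉0 = *-≉0 (t≉0 zero) (∏-≉0 (t ∘ suc) (t≉0 ∘ suc))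

  ∏-atZero : ∀ a → *.sum (atZero a ∘ enum) ≈ a
  ∏-atZero a = trans (sum-single *-monoid (atZero a ∘ enum) (index 0#) others) atZero-0
    where
    others : ∀ i → i ≢ index 0# → atZero a (enum i) ≈ 1#
    others i i≢0 with enum i ≟ 0#
    ... | yes i≈0 = ⊥-elim (i≢0 (enum-injective _ _ (trans i≈0 (sym (enum-index 0#)))))
    ... | no _ = refl
    atZero-0 : atZero a (enum (index 0#)) ≈ a
    atZero-0 with enum (index 0#) ≟ 0#
    ... | yes _ = refl
    ... | no ≉0 = ⊥-elim (≉0 (enum-index 0#))

  x^size≈x : ∀ x → x ^ size ≈ x
  x^size≈x a with a ≟ 0#
  ... | no a≉0 = sym (*-cancelˡ (∏-≉0 (orOne ∘ enum) (orOne-≉0 ∘ enum)) (begin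
    P * a                                 ≈⟨ *-cong P≈∏orOne[a*_] (sym (∏-atZero a)) ⟩
    *.sum (λ i → orOne (a * enum i)) * *.sum (atZero a ∘ enum)
                                          ≈⟨ *.∑-distrib-+ (λ i → orOne (a * enum i)) (atZero a ∘ enum) ⟨
    *.sum (λ i → orOne (a * enum i) * atZero a (enum i))
                                          ≈⟨ *.sum-cong-≋ {size} (orOne-* a≉0 ∘ enum) ⟩
    *.sum (λ i → a * orOne (enum i))      ≈⟨ *.∑-distrib-+ (λ _ → a) (orOne ∘ enum) ⟩
    *.sum {size} (λ _ → a) * P            ≈⟨ *-congʳ (trans (*.sum-replicate size) (sym (^≈E^ a size))) ⟩
    a ^ size * P                          ≈⟨ *-comm (a ^ size) P ⟩
    P * a ^ size                          ∎))
    where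
    P = *.sum (orOne ∘ enum)
    a⁻¹ = proj₁ (inverse a a≉0)
    a*a⁻¹ : ∀ x → a * (a⁻¹ * x) ≈ x
    a*a⁻¹ x = trans (sym (*-assoc a a⁻¹ x)) (trans (*-congʳ (proj₂ (inverse a a≉0))) (*-identityˡ x))
    a⁻¹*a : ∀ x → a⁻¹ * (a * x) ≈ x
    a⁻¹*a x = trans (sym (*-assoc a⁻¹ a x)) (trans (*-congʳ (trans (*-comm a⁻¹ a) (proj₂ (inverse a a≉0)))) (*-identityˡ x))
    P≈∏orOne[a*_] : P ≈ *.sum (λ i → orOne (a * enum i))
    P≈∏orOne[a*_] = ∑-reindex *-commutativeMonoid (a *_) (a⁻¹ *_) *-congˡ *-congˡ a*a⁻¹ a⁻¹*a orOne orOne-cong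
  ... | yes a≈0 = trans (^-congˡ size a≈0) (trans (0^size (index 0#)) (sym a≈0))
    where
    0^size : ∀ {n} → Fin n → 0# ^ n ≈ 0#
    0^size {suc n} _ = zeroˡ (0# ^ n)

  module _ (x y : Carrier) where
    open Binomial commutativeSemiring using (theorem; binomialTerm)

    binomialTerm-last : ∀ m → binomialTerm x y m (Fin.fromℕ m) ≈ x E.^ m
    binomialTerm-last m rewrite Finₚ.toℕ-fromℕ m | nCn≡1 m | ℕₚ.n∸n≡0 m =
      trans (+-identityʳ _) (*-identityʳ _)

    ^-additive-if-binomials-vanish : ∀ n → (∀ k → 0 ℕ.< k → k ℕ.< suc n → ∀ z → (suc n C k) · z ≈ 0#) →
                                     (x + y) ^ suc n ≈ x ^ suc n + y ^ suc n
    ^-additive-if-binomials-vanish n middle≈0 = begin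
      (x + y) ^ suc n                               ≈⟨ ^≈E^ (x + y) (suc n) ⟩
      (x + y) E.^ suc n                             ≈⟨ theorem (suc n) x y ⟩
      T zero + +.sum (T ∘ suc)                      ≈⟨ +-congˡ (+.sum-init-last (T ∘ suc)) ⟩
      T zero + (+.sum (T ∘ suc ∘ Fin.inject₁) + T (Fin.fromℕ (suc n)))
        ≈⟨ +-cong first (+-cong (trans (+.sum-cong-≋ {n} middle) (+.sum-replicate-zero n)) last) ⟩
      y ^ suc n + (0# + x ^ suc n)                  ≈⟨ +-congˡ (+-identityˡ (x ^ suc n)) ⟩
      y ^ suc n + x ^ suc n                         ≈⟨ +-comm (y ^ suc n) (x ^ suc n) ⟩
      x ^ suc n + y ^ suc n                         ∎
      where
      T = binomialTerm x y (suc n)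
      first : T zero ≈ y ^ suc n
      first = trans (+-identityʳ _) (trans (*-identityˡ _) (sym (^≈E^ y (suc n))))
      middle : ∀ i → T (suc (Fin.inject₁ i)) ≈ 0#
      middle i = middle≈0 _ (ℕ.s≤s ℕ.z≤n)
        (ℕ.s≤s (subst (ℕ._< n) (≡.sym (Finₚ.toℕ-inject₁ i)) (Finₚ.toℕ<n i))) _
      last : T (Fin.fromℕ (suc n)) ≈ x ^ suc n
      last = trans (binomialTerm-last (suc n)) (sym (^≈E^ x (suc n)))

  char∣⇒·≈0 : ∀ {p n} → p · 1# ≈ 0# → p ∣ n → ∀ z → n · z ≈ 0#
  char∣⇒·≈0 {p} p·1≈0 (divides d ≡.refl) z = begin
    (d *ℕ p) · z               ≈⟨ ·≈·1#* (d *ℕ p) z ⟩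
    ((d *ℕ p) · 1#) * z        ≈⟨ *-congʳ (×1-homo-* d p) ⟩
    ((d · 1#) * (p · 1#)) * z  ≈⟨ *-congʳ (trans (*-congˡ p·1≈0) (zeroʳ (d · 1#))) ⟩
    0# * z                     ≈⟨ zeroˡ z ⟩
    0#                         ∎

  frobenius : ∀ {p} → Prime p → p · 1# ≈ 0# → ∀ x y → (x + y) ^ p ≈ x ^ p + y ^ p
  frobenius {ℕ.zero} (prime {{()}} _)
  frobenius {suc n} p-prime p·1≈0 x y =
    ^-additive-if-binomials-vanish x y n λ k 0<k k<p → char∣⇒·≈0 p·1≈0 (prime∣C p-prime 0<k k<p)

  frobenius-^ : ∀ {p} → Prime p → p · 1# ≈ 0# → ∀ m x y → (x + y) ^ (p ^ℕ m) ≈ x ^ (p ^ℕ m) + y ^ (p ^ℕ m)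
  frobenius-^ p-prime p·1≈0 ℕ.zero x y = trans (*-identityʳ (x + y)) (sym (+-cong (*-identityʳ x) (*-identityʳ y)))
  frobenius-^ {p} p-prime p·1≈0 (suc m) x y = begin
    (x + y) ^ (p *ℕ pᵐ)                 ≈⟨ ^-assocʳ (x + y) p pᵐ ⟨
    ((x + y) ^ p) ^ pᵐ                  ≈⟨ ^-congˡ pᵐ (frobenius p-prime p·1≈0 x y) ⟩
    (x ^ p + y ^ p) ^ pᵐ                ≈⟨ frobenius-^ p-prime p·1≈0 m (x ^ p) (y ^ p) ⟩
    (x ^ p) ^ pᵐ + (y ^ p) ^ pᵐ         ≈⟨ +-cong (^-assocʳ x p pᵐ) (^-assocʳ y p pᵐ) ⟩
    x ^ (p *ℕ pᵐ) + y ^ (p *ℕ pᵐ)       ∎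
    where pᵐ = p ^ℕ m

  ·1#-zero-product : ∀ m n → (m *ℕ n) · 1# ≈ 0# → m · 1# ≈ 0# ⊎ n · 1# ≈ 0#
  ·1#-zero-product m n mn·1≈0 = x*y≈0⇒x≈0⊎y≈0 (trans (sym (×1-homo-* m n)) mn·1≈0)

  ^·1#≈0⇒·1#≈0 : ∀ p n → (p ^ℕ suc n) · 1# ≈ 0# → p · 1# ≈ 0#
  ^·1#≈0⇒·1#≈0 p ℕ.zero p¹·1≈0 = trans (sym (·-congˡ (ℕₚ.*-identityʳ p))) p¹·1≈0
  ^·1#≈0⇒·1#≈0 p (suc n) pⁿ⁺²·1≈0 with ·1#-zero-product p (p ^ℕ suc n) pⁿ⁺²·1≈0
  ... | inj₁ p·1≈0 = p·1≈0
  ... | inj₂ pⁿ⁺¹·1≈0 = ^·1#≈0⇒·1#≈0 p n pⁿ⁺¹·1≈0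

  odd-char⇒2·1#≉0 : ∀ {p m} → p ≡ 1 +ℕ m *ℕ 2 → p · 1# ≈ 0# → ¬ (2 · 1# ≈ 0#)
  odd-char⇒2·1#≉0 {m = m} ≡.refl p·1≈0 2·1≈0 = 1≉0 (begin
    1#                              ≈⟨ +-identityʳ 1# ⟨
    1# + 0#                         ≈⟨ +-congˡ (trans (*-congˡ 2·1≈0) (zeroʳ (m · 1#))) ⟨
    1# + (m · 1#) * (2 · 1#)        ≈⟨ +-congˡ (×1-homo-* m 2) ⟨
    (1 +ℕ m *ℕ 2) · 1#              ≈⟨ p·1≈0 ⟩
    0#                              ∎)

  x≈-x⇒x≈0 : ¬ (2 · 1# ≈ 0#) → ∀ {x} → x ≈ - x → x ≈ 0#
  x≈-x⇒x≈0 2·1≉0 {x} x≈-x with x*y≈0⇒x≈0⊎y≈0 2·1*x≈0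
    where
    2·1*x≈0 : (2 · 1#) * x ≈ 0#
    2·1*x≈0 = begin
      (2 · 1#) * x   ≈⟨ ·≈·1#* 2 x ⟨
      x + (x + 0#)   ≈⟨ +-congˡ (+-identityʳ x) ⟩
      x + x          ≈⟨ +-congˡ x≈-x ⟩
      x - x          ≈⟨ -‿inverseʳ x ⟩
      0#             ∎
  ... | inj₁ 2·1≈0 = ⊥-elim (2·1≉0 2·1≈0)
  ... | inj₂ x≈0 = x≈0

  count-symmetric-fibre : ∀ (h : Carrier → Carrier) α → (∀ {x y} → x ≈ y → h x ≈ h y) →
    (∀ x → h x ≈ α → h (- x) ≈ α) → (∀ x → h x ≈ α → ¬ (x ≈ - x)) →
    (∀ x y → h x ≈ α → h y ≈ α → y ≈ x ⊎ y ≈ - x) →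
    count (λ x → h x ≟ α) ≡ 0 ⊎ count (λ x → h x ≟ α) ≡ 2
  count-symmetric-fibre h α h-cong h-even x≉-x fibre≈± with Finₚ.any? (λ i → h (enum i) ≟ α)
  ... | no none = inj₁ (length-filter-tabulate-none _ (λ i → i) λ i Qi → none (i , Qi))
  ... | yes (i , Qi) = inj₂ (length-filter-tabulate-two _ (λ i → i) i j i≢j Qi Qj only)
    where
    j = index (- enum i)
    Qj : h (enum j) ≈ α
    Qj = trans (h-cong (enum-index _)) (h-even (enum i) Qi)
    i≢j : i ≢ j
    i≢j i≡j = x≉-x (enum i) Qi (trans (reflexive (cong enum i≡j)) (enum-index _))
    only : ∀ m → h (enum m) ≈ α → m ≡ i ⊎ m ≡ j
    only m Qm with fibre≈± (enum i) (enum m) Qi Qm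
    ... | inj₁ m≈i = inj₁ (enum-injective m i m≈i)
    ... | inj₂ m≈-i = inj₂ (enum-injective m j (trans m≈-i (sym (enum-index _))))

  module TraceForm (q : ℕ) (^q-additive : ∀ x y → (x + y) ^ q ≈ x ^ q + y ^ q)
                   (^q-involutive : ∀ x → (x ^ q) ^ q ≈ x) where

    0^q≈0 : 0# ^ q ≈ 0#
    0^q≈0 = +-identityʳ-unique (0# ^ q) (0# ^ q)
      (trans (sym (^q-additive 0# 0#)) (^-congˡ q (+-identityʳ 0#)))

    -x^q≈-[x^q] : ∀ x → (- x) ^ q ≈ - (x ^ q)
    -x^q≈-[x^q] x = +-inverseˡ-unique ((- x) ^ q) (x ^ q)
      (trans (sym (^q-additive (- x) x)) (trans (^-congˡ q (-‿inverseˡ x)) 0^q≈0))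

    trace : Carrier → Carrier
    trace x = x ^ q + x

    trace-^q : ∀ x → trace x ^ q ≈ trace x
    trace-^q x = trans (^q-additive (x ^ q) x) (trans (+-congʳ (^q-involutive x)) (+-comm x (x ^ q)))

    trace-neg : ∀ x → trace (- x) ≈ - trace x
    trace-neg x = trans (+-congʳ (-x^q≈-[x^q] x)) (-‿+-comm (x ^ q) x)

    x*trace≈y*trace⇒trace²≈trace² : ∀ {x y} → x * trace x ≈ y * trace y →
                                    trace x * trace x ≈ trace y * trace y
    x*trace≈y*trace⇒trace²≈trace² {x} {y} eq = begin
      trace x * trace x                    ≈⟨ distribʳ (trace x) (x ^ q) x ⟩
      x ^ q * trace x + x * trace x        ≈⟨ +-cong eq^q eq ⟩
      y ^ q * trace y + y * trace y        ≈⟨ distribʳ (trace y) (y ^ q) y ⟨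
      trace y * trace y                    ∎
      where
      eq^q : x ^ q * trace x ≈ y ^ q * trace y
      eq^q = begin
        x ^ q * trace x            ≈⟨ *-congˡ (trace-^q x) ⟨
        x ^ q * trace x ^ q        ≈⟨ ^-distrib-* x (trace x) q ⟨
        (x * trace x) ^ q          ≈⟨ ^-congˡ q eq ⟩
        (y * trace y) ^ q          ≈⟨ ^-distrib-* y (trace y) q ⟩
        y ^ q * trace y ^ q        ≈⟨ *-congˡ (trace-^q y) ⟩
        y ^ q * trace y            ∎

    x*trace≈y*trace⇒y≈±x : ∀ {x y} → ¬ (trace x ≈ 0#) → x * trace x ≈ y * trace y → y ≈ x ⊎ y ≈ - x
    x*trace≈y*trace⇒y≈±x {x} {y} trace≉0 eq with x*x≈y*y⇒x≈y⊎x≈-y (sym (x*trace≈y*trace⇒trace²≈trace² eq))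
    ... | inj₁ Ty≈Tx = inj₁ (*-cancelˡ trace≉0 (begin
      trace x * y   ≈⟨ *-congʳ Ty≈Tx ⟨
      trace y * y   ≈⟨ *-comm (trace y) y ⟩
      y * trace y   ≈⟨ eq ⟨
      x * trace x   ≈⟨ *-comm x (trace x) ⟩
      trace x * x   ∎))
    ... | inj₂ Ty≈-Tx = inj₂ (trans (sym (-‿involutive y)) (-‿cong (*-cancelˡ trace≉0 (begin
      trace x * - y    ≈⟨ -‿distribʳ-* (trace x) y ⟨
      - (trace x * y)  ≈⟨ -‿distribˡ-* (trace x) y ⟩
      - trace x * y    ≈⟨ *-congʳ Ty≈-Tx ⟨
      trace y * y      ≈⟨ *-comm (trace y) y ⟩
      y * trace y      ≈⟨ eq ⟨
      x * trace x      ≈⟨ *-comm x (trace x) ⟩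
      trace x * x      ∎))))

    module _ (a : Carrier) where

      f : Carrier → Carrier
      f x = a * (x ^ (q +ℕ 1) + x ^ 2)

      f≈a*x*trace : ∀ x → f x ≈ a * (x * trace x)
      f≈a*x*trace x = *-congˡ (begin
        x ^ (q +ℕ 1) + x ^ 2        ≈⟨ +-congʳ (^-homo-* x q 1) ⟩
        x ^ q * (x * 1#) + x * (x * 1#)
                                    ≈⟨ +-cong (trans (*-congˡ (*-identityʳ x)) (*-comm (x ^ q) x)) (*-congˡ (*-identityʳ x)) ⟩
        x * x ^ q + x * x           ≈⟨ distribˡ x (x ^ q) x ⟨
        x * trace x                 ∎)

      f-cong : ∀ {x y} → x ≈ y → f x ≈ f y
      f-cong x≈y = *-congˡ (+-cong (^-congˡ (q +ℕ 1) x≈y) (^-congˡ 2 x≈y))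

      f-neg : ∀ x → f (- x) ≈ f x
      f-neg x = begin
        f (- x)                      ≈⟨ f≈a*x*trace (- x) ⟩
        a * (- x * trace (- x))      ≈⟨ *-congˡ (*-congˡ (trace-neg x)) ⟩
        a * (- x * - trace x)        ≈⟨ *-congˡ (-‿distribˡ-* x (- trace x)) ⟨
        a * - (x * - trace x)        ≈⟨ *-congˡ (-‿cong (-‿distribʳ-* x (trace x))) ⟨
        a * - - (x * trace x)        ≈⟨ *-congˡ (-‿involutive (x * trace x)) ⟩
        a * (x * trace x)            ≈⟨ f≈a*x*trace x ⟨
        f x                          ∎

      count-fibre : ¬ (a ≈ 0#) → ¬ (2 · 1# ≈ 0#) → ∀ {α} → ¬ (α ≈ 0#) →
                    count (λ x → f x ≟ α) ≡ 0 ⊎ count (λ x → f x ≟ α) ≡ 2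
      count-fibre a≉0 2·1≉0 {α} α≉0 = count-symmetric-fibre f α f-cong
        (λ x fx≈α → trans (f-neg x) fx≈α)
        (λ x fx≈α x≈-x → x*trace≉0 fx≈α (trans (*-congʳ (x≈-x⇒x≈0 2·1≉0 x≈-x)) (zeroˡ (trace x))))
        (λ x y fx≈α fy≈α → x*trace≈y*trace⇒y≈±x (trace≉0 fx≈α)
          (*-cancelˡ a≉0 (trans (sym (f≈a*x*trace x)) (trans fx≈α (trans (sym fy≈α) (f≈a*x*trace y))))))
        where
        x*trace≉0 : ∀ {x} → f x ≈ α → ¬ (x * trace x ≈ 0#)
        x*trace≉0 {x} fx≈α x*trace≈0 =
          α≉0 (trans (sym fx≈α) (trans (f≈a*x*trace x) (trans (*-congˡ x*trace≈0) (zeroʳ a))))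
        trace≉0 : ∀ {x} → f x ≈ α → ¬ (trace x ≈ 0#)
        trace≉0 {x} fx≈α trace≈0 = x*trace≉0 fx≈α (trans (*-congˡ trace≈0) (zeroʳ x))

lemma3p4 : ∀ {c ℓ : Level} (F : FiniteField c ℓ) → let open FiniteField F in
  ∀ (p k q : ℕ) → Prime p → p ≢ 2 → q ≡ p ^ℕ (suc k) → size ≡ q *ℕ q →
  ∀ (cc b β α : Carrier) →
  cc ^ q ≈ cc → ¬ (cc ≈ 0#) →
  b ^ q ≈ b → (¬ ∃ λ t → (t ^ q ≈ t) × (t * t ≈ b)) →
  β * β ≈ b →
  (¬ ∃ λ t → (t ^ q ≈ t) × (α ≈ β * t)) →
  let f : Carrier → Carrier
      f X = cc * (X ^ (q +ℕ 1) + X ^ 2)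
  in (count (λ γ → f γ ≟ α) ≡ 0) ⊎ (count (λ γ → f γ ≟ α) ≡ 2)
lemma3p4 F p k q p-prime p≢2 ≡.refl size≡q*q cc _ β α _ cc≉0 _ _ _ α∉βFq =
  count-fibre cc cc≉0 (odd-char⇒2·1#≉0 {m = p / 2} (prime≢2⇒odd p-prime p≢2) p·1≈0) α≉0
  where
  open FiniteField F
  open FiniteFieldProperties F

  p·1≈0 : p · 1# ≈ 0#
  p·1≈0 = ^·1#≈0⇒·1#≈0 p k (reduce (·1#-zero-product q q (subst (λ n → n · 1# ≈ 0#) size≡q*q size·1≈0)))

  x^q^q≈x : ∀ x → (x ^ q) ^ q ≈ x
  x^q^q≈x x = trans (^-assocʳ x q q) (subst (λ n → x ^ n ≈ x) size≡q*q (x^size≈x x))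

  open TraceForm q (frobenius-^ p-prime p·1≈0 (suc k)) x^q^q≈x

  α≉0 : ¬ (α ≈ 0#)
  α≉0 α≈0 = α∉βFq (0# , 0^q≈0 , trans α≈0 (sym (zeroʳ β)))
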